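{- Let $k$ be a positive integer and let $r$ be the auxiliary number of $K(2k,k)$. Then the auxiliary number of $K(4k,2k)$ is less than or equal to $r+1$.
   Context: For positive integers $n\geq 2k$, let $P[n,k]$ denote the set of $k$-element subsets of $[n]=\{1,\ldots,n\}$ (the vertex set of the Kneser graph $K(n,k)$). A family $\{V_1,\ldots,V_r\}\subseteq P[n,k]$ is called an auxiliary set for $K(n,k)$ if $\bigcup_{i=1}^r V_i=[n]$ and there is no pair of distinct elements $a,b\in[n]$ such that for each $i$ either $\{a,b\}\subseteq V_i$ or $\{a,b\}\subseteq [n]\setminus V_i$. The auxiliary number of $K(n,k)$ is the minimum cardinality of an auxiliary set for $K(n,k)$. -}

module Defs where

open import Data.Nat using (ℕ; _≤_)
open import Data.Fin using (Fin)
open import Data.Fin.Subset using (Subset; _∈_; _∉_; ∣_∣)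
open import Data.Product using (Σ; ∃; _×_)
open import Data.Sum using (_⊎_)
open import Relation.Nullary using (¬_)
open import Relation.Binary.PropositionalEquality using (_≡_; _≢_)
open import Function.Definitions using (Injective)

InP : (n k : ℕ) → Subset n → Set
InP n k V = ∣ V ∣ ≡ k

record Family (n k r : ℕ) : Set where
  field
    V        : Fin r → Subset n
    distinct : Injective _≡_ _≡_ V
    members  : ∀ i → InP n k (V i)

open Family public

SameSide : ∀ {n} → Subset n → Fin n → Fin n → Set
SameSide V a b = (a ∈ V × b ∈ V) ⊎ (a ∉ V × b ∉ V)

IsAuxiliary : ∀ {n k r} → Family n k r → Set
IsAuxiliary {n} {k} {r} F =
  (∀ (a : Fin n) → ∃ λ (i : Fin r) → a ∈ V F i)
  × ¬ (Σ (Fin n) λ a → Σ (Fin n) λ b → a ≢ b × (∀ (i : Fin r) → SameSide (V F i) a b))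

HasAuxiliaryOfSize : ℕ → ℕ → ℕ → Set
HasAuxiliaryOfSize n k r = Σ (Family n k r) IsAuxiliary

IsAuxiliaryNumber : ℕ → ℕ → ℕ → Set
IsAuxiliaryNumber n k r =
  HasAuxiliaryOfSize n k r × (∀ s → HasAuxiliaryOfSize n k s → r ≤ s)

-- Double the ground set: a point of [4k] is a copy a ↑ˡ 2k or 2k ↑ʳ a of a point a of [2k].
-- Replace each V_i by the union V_i ++ V_i of its two copies and add the left half ⊤ ++ ⊥.
-- The doubled sets separate points of the same half exactly as the V_i do, while the new set
-- separates the two halves; so K(4k,2k) has an auxiliary set of size r + 1. Whether an
-- auxiliary set of a given size exists is decidable by exhaustive search, so the auxiliary
-- number of K(4k,2k) exists and is at most r + 1.
module Submission where

open import Defs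
open import Data.Bool using (true; false)
open import Data.Empty using (⊥-elim)
open import Data.Fin using (Fin; _↑ˡ_; _↑ʳ_; splitAt) renaming (zero to fzero; suc to fsuc)
open import Data.Fin.Properties using (any?; all?; join-splitAt) renaming (_≟_ to _≟ᶠ_)
open import Data.Fin.Subset using (Subset; _∈_; ∣_∣; ⊤; ⊥)
open import Data.Fin.Subset.Properties using (_∈?_; ∈⊤; ∉⊥; ∣⊤∣≡n; ∣⊥∣≡0; anySubset?)
open import Data.Nat using (ℕ; zero; suc; _+_; _*_; _≤_; _<_; _≟_)
open import Data.Nat.Properties using (+-identityʳ; +-suc; <⇒≢; *-distribʳ-+; ≮⇒≥; m<1+n⇒m<n∨m≡n)
open import Data.Product using (Σ; ∃; _×_; _,_; proj₂)
open import Data.Sum using (inj₁; inj₂)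
open import Data.Vec using (Vec; []; _∷_; _++_; lookup; tabulate)
open import Data.Vec.Properties using ([]=⇒lookup; lookup⇒[]=; lookup-++ˡ; lookup-++ʳ; ++-injectiveˡ; ++-injectiveʳ; lookup∘tabulate; ≡-dec)
import Data.Bool.Properties as Bool
open import Function.Definitions using (Injective)
open import Relation.Nullary using (¬_; Dec; yes; no; ¬?)
open import Relation.Nullary.Decidable using (map′; _×-dec_; _⊎-dec_; _→-dec_)
open import Relation.Unary using (Pred; Decidable)
open import Relation.Binary.PropositionalEquality

∈-resp-lookup : ∀ {m n} {p : Subset m} {q : Subset n} {x y} →
                lookup p x ≡ lookup q y → x ∈ p → y ∈ q
∈-resp-lookup {q = q} {y = y} eq x∈p = lookup⇒[]= y q (trans (sym eq) ([]=⇒lookup x∈p))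

∈-++⁺ˡ : ∀ {m n} {p : Subset m} {q : Subset n} {a} → a ∈ p → a ↑ˡ n ∈ p ++ q
∈-++⁺ˡ {p = p} {q} {a} = ∈-resp-lookup (sym (lookup-++ˡ p q a))

∈-++⁺ʳ : ∀ {m n} {p : Subset m} {q : Subset n} {b} → b ∈ q → m ↑ʳ b ∈ p ++ q
∈-++⁺ʳ {p = p} {q} {b} = ∈-resp-lookup (sym (lookup-++ʳ p q b))

∈-++⁻ʳ : ∀ {m n} {p : Subset m} {q : Subset n} {b} → m ↑ʳ b ∈ p ++ q → b ∈ q
∈-++⁻ʳ {p = p} {q} {b} = ∈-resp-lookup (lookup-++ʳ p q b)

∣p++q∣≡∣p∣+∣q∣ : ∀ {m n} (p : Subset m) (q : Subset n) → ∣ p ++ q ∣ ≡ ∣ p ∣ + ∣ q ∣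
∣p++q∣≡∣p∣+∣q∣ []          q = refl
∣p++q∣≡∣p∣+∣q∣ (true ∷ p)  q = cong suc (∣p++q∣≡∣p∣+∣q∣ p q)
∣p++q∣≡∣p∣+∣q∣ (false ∷ p) q = ∣p++q∣≡∣p∣+∣q∣ p q

sameSide-resp-lookup : ∀ {m n} {p : Subset m} {q : Subset n} {a b c d} →
  lookup p a ≡ lookup q c → lookup p b ≡ lookup q d → SameSide p a b → SameSide q c d
sameSide-resp-lookup ac bd (inj₁ (a∈ , b∈)) = inj₁ (∈-resp-lookup ac a∈ , ∈-resp-lookup bd b∈)
sameSide-resp-lookup ac bd (inj₂ (a∉ , b∉)) =
  inj₂ ((λ c∈ → a∉ (∈-resp-lookup (sym ac) c∈)) , (λ d∈ → b∉ (∈-resp-lookup (sym bd) d∈)))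

sameSide-++ˡ : ∀ {m n} (p : Subset m) (q : Subset n) {a b} →
               SameSide (p ++ q) (a ↑ˡ n) (b ↑ˡ n) → SameSide p a b
sameSide-++ˡ p q {a} {b} = sameSide-resp-lookup (lookup-++ˡ p q a) (lookup-++ˡ p q b)

sameSide-++ʳ : ∀ {m n} (p : Subset m) (q : Subset n) {a b} →
               SameSide (p ++ q) (m ↑ʳ a) (m ↑ʳ b) → SameSide q a b
sameSide-++ʳ p q {a} {b} = sameSide-resp-lookup (lookup-++ʳ p q a) (lookup-++ʳ p q b)

∈-sameSide : ∀ {n} {p : Subset n} {a b} → SameSide p a b → a ∈ p → b ∈ p
∈-sameSide (inj₁ (_ , b∈)) _  = b∈
∈-sameSide (inj₂ (a∉ , _)) a∈ = ⊥-elim (a∉ a∈)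

sameSide-sym : ∀ {n} {p : Subset n} {a b} → SameSide p a b → SameSide p b a
sameSide-sym (inj₁ (a∈ , b∈)) = inj₁ (b∈ , a∈)
sameSide-sym (inj₂ (a∉ , b∉)) = inj₂ (b∉ , a∉)

¬sameSide-halves : ∀ {n} (a b : Fin n) → ¬ SameSide (⊤ {n} ++ ⊥ {n}) (a ↑ˡ n) (n ↑ʳ b)
¬sameSide-halves {n} a b same = ∉⊥ (∈-++⁻ʳ {p = ⊤ {n}} (∈-sameSide same (∈-++⁺ˡ ∈⊤)))

data Half (m n : ℕ) : Fin (m + n) → Set where
  left  : ∀ a → Half m n (a ↑ˡ n)
  right : ∀ b → Half m n (m ↑ʳ b)

half : ∀ m n (x : Fin (m + n)) → Half m n x
half m n x with splitAt m x | join-splitAt m n x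
... | inj₁ a | refl = left a
... | inj₂ b | refl = right b

Covers : ∀ {n r} → (Fin r → Subset n) → Set
Covers {n} {r} W = ∀ (a : Fin n) → ∃ λ (i : Fin r) → a ∈ W i

Separates : ∀ {n r} → (Fin r → Subset n) → Set
Separates {n} {r} W =
  ¬ (Σ (Fin n) λ a → Σ (Fin n) λ b → a ≢ b × (∀ (i : Fin r) → SameSide (W i) a b))

IsAuxiliaryFamily : ∀ n k {r} → (Fin r → Subset n) → Set
IsAuxiliaryFamily n k W = Injective _≡_ _≡_ W × (∀ i → InP n k (W i)) × Covers W × Separates W

hasAuxiliary⇒family : ∀ {n k r} → HasAuxiliaryOfSize n k r → ∃ (IsAuxiliaryFamily n k {r})
hasAuxiliary⇒family (F , covers , separates) = V F , distinct F , members F , covers , separates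

family⇒hasAuxiliary : ∀ {n k r} {W : Fin r → Subset n} → IsAuxiliaryFamily n k W →
                      HasAuxiliaryOfSize n k r
family⇒hasAuxiliary {W = W} (inj , mem , covers , separates) =
  record { V = W ; distinct = inj ; members = mem } , covers , separates

module Doubling {n k r : ℕ} (n≡k+k : n ≡ k + k) (0<k : 0 < k) (V : Fin r → Subset n)
  (V-injective : Injective _≡_ _≡_ V) (∣V∣ : ∀ i → ∣ V i ∣ ≡ k)
  (V-covers : Covers V) (V-separates : Separates V) where

  W : Fin (suc r) → Subset (n + n)
  W fzero    = ⊤ {n} ++ ⊥ {n}
  W (fsuc i) = V i ++ V i

  ⊥≢V : ∀ i → ⊥ ≢ V i
  ⊥≢V i ⊥≡Vi = <⇒≢ 0<k (trans (sym (∣⊥∣≡0 n)) (trans (cong ∣_∣ ⊥≡Vi) (∣V∣ i)))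

  W-injective : Injective _≡_ _≡_ W
  W-injective {fzero}  {fzero}  _  = refl
  W-injective {fzero}  {fsuc j} eq = ⊥-elim (⊥≢V j (++-injectiveʳ (⊤ {n}) (V j) eq))
  W-injective {fsuc i} {fzero}  eq = ⊥-elim (⊥≢V i (sym (++-injectiveʳ (V i) (⊤ {n}) eq)))
  W-injective {fsuc i} {fsuc j} eq = cong fsuc (V-injective (++-injectiveˡ (V i) (V j) eq))

  ∣W∣ : ∀ i → ∣ W i ∣ ≡ n
  ∣W∣ fzero = begin
    ∣ ⊤ {n} ++ ⊥ {n} ∣  ≡⟨ ∣p++q∣≡∣p∣+∣q∣ (⊤ {n}) (⊥ {n}) ⟩
    ∣ ⊤ {n} ∣ + ∣ ⊥ {n} ∣ ≡⟨ cong₂ _+_ (∣⊤∣≡n n) (∣⊥∣≡0 n) ⟩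
    n + 0               ≡⟨ +-identityʳ n ⟩
    n                   ∎
    where open ≡-Reasoning
  ∣W∣ (fsuc i) = begin
    ∣ V i ++ V i ∣      ≡⟨ ∣p++q∣≡∣p∣+∣q∣ (V i) (V i) ⟩
    ∣ V i ∣ + ∣ V i ∣   ≡⟨ cong₂ _+_ (∣V∣ i) (∣V∣ i) ⟩
    k + k               ≡⟨ sym n≡k+k ⟩
    n                   ∎
    where open ≡-Reasoning

  W-covers : Covers W
  W-covers x with half n n x
  ... | left a  = fzero , ∈-++⁺ˡ {p = ⊤ {n}} ∈⊤
  ... | right b with V-covers b
  ...   | i , b∈Vi = fsuc i , ∈-++⁺ʳ {p = V i} b∈Vi

  W-separates : Separates W
  W-separates (x , y , x≢y , same) with half n n x | half n n y
  ... | left a  | left b  = V-separates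
        (a , b , (λ a≡b → x≢y (cong (_↑ˡ n) a≡b)) , λ i → sameSide-++ˡ (V i) (V i) (same (fsuc i)))
  ... | right a | right b = V-separates
        (a , b , (λ a≡b → x≢y (cong (n ↑ʳ_) a≡b)) , λ i → sameSide-++ʳ (V i) (V i) (same (fsuc i)))
  ... | left a  | right b = ¬sameSide-halves a b (same fzero)
  ... | right a | left b  = ¬sameSide-halves b a (sameSide-sym (same fzero))

  doubled : IsAuxiliaryFamily (n + n) n W
  doubled = W-injective , ∣W∣ , W-covers , W-separates

hasAuxiliary-double : ∀ {n k r} → n ≡ k + k → 0 < k →
                      HasAuxiliaryOfSize n k r → HasAuxiliaryOfSize (n + n) n (suc r)
hasAuxiliary-double n≡k+k 0<k has with hasAuxiliary⇒family has
... | V , inj , ∣V∣ , covers , separates =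
  family⇒hasAuxiliary (Doubling.doubled n≡k+k 0<k V inj ∣V∣ covers separates)

Searchable : Set → Set₁
Searchable A = {P : Pred A _} → Decidable P → Dec (∃ P)

searchable-Vec : ∀ {A} → Searchable A → ∀ s → Searchable (Vec A s)
searchable-Vec search zero    P? = map′ ([] ,_) (λ { ([] , p) → p }) (P? [])
searchable-Vec search (suc s) P? =
  map′ (λ (a , v , p) → a ∷ v , p) (λ { (a ∷ v , p) → a , v , p })
       (search λ a → searchable-Vec search s λ v → P? (a ∷ v))

injective? : ∀ {n r} (W : Fin r → Subset n) → Dec (Injective _≡_ _≡_ W)
injective? W = map′ (λ inj {i} {j} → inj i j) (λ inj i j → inj {i} {j})
  (all? λ i → all? λ j → ≡-dec Bool._≟_ (W i) (W j) →-dec (i ≟ᶠ j))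

sameSide? : ∀ {n} (p : Subset n) a b → Dec (SameSide p a b)
sameSide? p a b = ((a ∈? p) ×-dec (b ∈? p)) ⊎-dec (¬? (a ∈? p) ×-dec ¬? (b ∈? p))

isAuxiliaryFamily? : ∀ n k {r} → Decidable (IsAuxiliaryFamily n k {r})
isAuxiliaryFamily? n k W =
  injective? W ×-dec all? (λ i → ∣ W i ∣ ≟ k) ×-dec
  all? (λ a → any? λ i → a ∈? W i) ×-dec
  ¬? (any? λ a → any? λ b → ¬? (a ≟ᶠ b) ×-dec all? λ i → sameSide? (W i) a b)

isAuxiliaryFamily-resp-≗ : ∀ {n k r} {W W′ : Fin r → Subset n} → (∀ i → W i ≡ W′ i) →
                           IsAuxiliaryFamily n k W → IsAuxiliaryFamily n k W′
isAuxiliaryFamily-resp-≗ {W = W} {W′} W≗W′ (inj , mem , covers , separates) =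
  (λ {i} {j} eq → inj (trans (W≗W′ i) (trans eq (sym (W≗W′ j))))) ,
  (λ i → subst (λ p → ∣ p ∣ ≡ _) (W≗W′ i) (mem i)) ,
  (λ a → let (i , a∈) = covers a in i , subst (a ∈_) (W≗W′ i) a∈) ,
  λ (a , b , a≢b , same) → separates
    (a , b , a≢b , λ i → subst (λ p → SameSide p a b) (sym (W≗W′ i)) (same i))

hasAuxiliaryOfSize? : ∀ n k r → Dec (HasAuxiliaryOfSize n k r)
hasAuxiliaryOfSize? n k r =
  map′ (λ (v , aux) → family⇒hasAuxiliary aux)
       (λ has → let (W , aux) = hasAuxiliary⇒family has in
                tabulate W , isAuxiliaryFamily-resp-≗ (λ i → sym (lookup∘tabulate W i)) aux)
       (searchable-Vec anySubset? r λ v → isAuxiliaryFamily? n k (lookup v))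

Least : (ℕ → Set) → ℕ → Set
Least P s = P s × (∀ t → P t → s ≤ t)

-- Scans i, suc i, …; the fuel f keeps the known witness at f + i.
least-above : ∀ {P : ℕ → Set} → Decidable P → ∀ f i →
             (∀ {t} → t < i → ¬ P t) → P (f + i) → ∃ (Least P)
least-above P? f i below p with P? i
least-above P? f       i below p | yes Pi = i , Pi , λ t Pt → ≮⇒≥ (λ t<i → below t<i Pt)
least-above P? zero    i below p | no ¬Pi = ⊥-elim (¬Pi p)
least-above {P} P? (suc f) i below p | no ¬Pi =
  least-above P? f (suc i) below′ (subst P (sym (+-suc f i)) p)
  where
  below′ : ∀ {t} → t < suc i → ¬ P t
  below′ t<1+i with m<1+n⇒m<n∨m≡n t<1+i
  ... | inj₁ t<i  = below t<i
  ... | inj₂ refl = ¬Pi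

∃-least : ∀ {P : ℕ → Set} → Decidable P → ∀ {m} → P m → ∃ (Least P)
∃-least {P} P? {m} p = least-above P? m 0 (λ ()) (subst P (sym (+-identityʳ m)) p)

mainTheorem4 : (k : ℕ) → 1 ≤ k → (r : ℕ) → IsAuxiliaryNumber (2 * k) k r →
    Σ ℕ λ s → IsAuxiliaryNumber (4 * k) (2 * k) s × s ≤ suc r
mainTheorem4 k 0<k r (has , _) =
  let s , isLeast = ∃-least (hasAuxiliaryOfSize? (4 * k) (2 * k)) doubled
  in  s , isLeast , proj₂ isLeast (suc r) doubled
  where
  2k≡k+k : 2 * k ≡ k + k
  2k≡k+k = cong (k +_) (+-identityʳ k)

  doubled : HasAuxiliaryOfSize (4 * k) (2 * k) (suc r)
  doubled = subst (λ m → HasAuxiliaryOfSize m (2 * k) (suc r)) (sym (*-distribʳ-+ k 2 2))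
                  (hasAuxiliary-double 2k≡k+k 0<k has)
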